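{- For every formula $A$ of $\mathscr{L}$, $\models^{SH}_\Delta A\vee\neg A$; that is, there is an argument $\langle\mathscr{D},\Sigma\rangle$ from $\emptyset$ to $A\vee\neg A$ which is SH-valid on every (consistent) atomic base $\mathfrak{B}$.
   Context: The meta-language reasoning is classical. Language $\mathscr{L}$: formulas $X ::= p \mid \bot \mid X\wedge X \mid X \vee X \mid X \rightarrow X$ ($p$ propositional atoms; the $p$'s and $\bot$ are atoms); $\neg A := A\rightarrow\bot$. An atomic base $\mathfrak{B}$ is a countable set of production rules with atomic premises $A_1,\dots,A_n$ ($n\ge0$, $A_i\neq\bot$) and atomic conclusion; $\texttt{DER}_{\mathfrak{B}}$ is the set of its derivations, and bases are required to be consistent ($\bot$ is not derivable). An argument structure is a pair $\langle T,f\rangle$ where $T$ is a finite tree whose nodes are formulas of $\mathscr{L}$ or empty (empty nodes only as top-nodes), and $f$ is a function defined on a subset of the non-empty top-nodes assigning to each such node a node below it (discharge). Top-nodes are assumptions, the root is the conclusion; the structure is closed if all assumptions are discharged, else open; it is "from $\Gamma$ to $A$" if $\Gamma$ is its set of undischarged assumptions and $A$ its conclusion. For $\mathscr{D}$ from $\Gamma$ to $A$ and $\sigma$ assigning to each $B\in\Gamma$ a closed argument structure with conclusion $B$, $\mathscr{D}^\sigma$ is obtained by replacing each $B\in\Gamma$ by $\sigma(B)$. The introduction rules are: from $A$ and $B$ infer $A\wedge B$; from $A_i$ infer $A_1\vee A_2$ ($i=1,2$); from $B$ infer $A\rightarrow B$ discharging $A$; an argument structure is canonical iff its last step is an instance of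 an introduction rule. A reduction is a pair $\langle\mathscr{D}^1,\mathscr{D}^2\rangle$ of argument structures where $\mathscr{D}^2$ has the same conclusion as, and at most the same assumptions as, $\mathscr{D}^1$. An r-system is a set of reductions. An r-sequence $\langle\mathscr{D}^1_1,\mathscr{D}^2_1\rangle,\dots,\langle\mathscr{D}^1_n,\mathscr{D}^2_n\rangle$ with $\mathscr{D}^2_{i-1}=\mathscr{D}^1_i$ for each $i$ is from $\mathscr{D}^1_1$ to $\mathscr{D}^2_n$. For an r-system $\Sigma$, $\mathscr{D}\le^\Sigma\mathscr{D}^*$ iff $\Sigma$ contains an r-sequence from $\mathscr{D}$ to $\mathscr{D}^*$. An argument is a pair $\langle\mathscr{D},\Sigma\rangle$. It is SH-valid on $\mathfrak{B}$ iff: (i) if $\mathscr{D}$ is closed with atomic conclusion, then $\mathscr{D}\le^{\Sigma}\langle T,\emptyset\rangle$ for some closed $T\in\texttt{DER}_{\mathfrak{B}}$; (ii) if $\mathscr{D}$ is closed with non-atomic conclusion, then $\mathscr{D}\le^{\Sigma}\mathscr{D}^*$ for some closed canonical $\mathscr{D}^*$ whose immediate sub-structures, paired with $\Sigma$, are SH-valid on $\mathfrak{B}$; (iii) if $\mathscr{D}$ is open from $\Gamma$ to $A$, then for every $\sigma$ and every r-system $\Sigma^+\supseteq\Sigma$, if $\langle\sigma(B),\Sigma^+\rangle$ is SH-valid on $\mathfrak{B}$ for the $B\in\Gamma$, then $\langle\mathscr{D}^\sigma,\Sigma^+\rangle$ is SH-valid on $\mathfrak{B}$. Finally, $\Gamma\models^{SH}_\Delta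 A$ iff there is an argument $\langle\mathscr{D},\Sigma\rangle$ from $\Gamma$ to $A$ that is SH-valid on every base $\mathfrak{B}$. -}

module Defs where

open import Level using (Level; 0ℓ; Lift) renaming (suc to lsuc)
open import Data.Nat using (ℕ; zero; suc; _≤_; _≤ᵇ_; _≡ᵇ_)
open import Data.Bool using (if_then_else_)
open import Data.Maybe using (Maybe; just; nothing)
open import Data.List using (List; []; _∷_; _++_)
open import Data.List.Membership.Propositional using (_∈_)
open import Data.List.Relation.Binary.Subset.Propositional using (_⊆_)
open import Data.List.Relation.Unary.All using (All)
open import Data.Product using (Σ; ∃; ∃-syntax; _×_; _,_)
open import Data.Sum using (_⊎_)
open import Data.Unit using (⊤)
open import Data.Empty renaming (⊥ to Empty)
open import Relation.Nullary using (¬_)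
open import Relation.Binary.PropositionalEquality using (_≡_; _≢_)
open import Relation.Binary.Construct.Closure.Transitive using (TransClosure)

infixr 6 _∧ᶠ_
infixr 5 _∨ᶠ_
infixr 4 _⇒_

data Formula : Set where
  var  : ℕ → Formula
  ⊥ᶠ   : Formula
  _∧ᶠ_ : Formula → Formula → Formula
  _∨ᶠ_ : Formula → Formula → Formula
  _⇒_  : Formula → Formula → Formula

¬ᶠ_ : Formula → Formula
¬ᶠ A = A ⇒ ⊥ᶠ

data Atomic : Formula → Set where
  var-at : ∀ n → Atomic (var n)
  ⊥-at   : Atomic ⊥ᶠ

-- A finite ordered tree; empty nodes occur only as top-nodes.
--   emp          : an empty top-node
--   hyp A d      : a top-node labelled A; d = nothing means f is undefined
--                  on it, d = just k means f sends it to the node k+1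
--                  steps below it (its (k+1)-th ancestor)
--   nd A t ts    : an inner node labelled A with children t ∷ ts (≥ 1)
-- The discharge function f is thus encoded in the top-nodes.

data Tree : Set where
  emp : Tree
  hyp : Formula → Maybe ℕ → Tree
  nd  : Formula → Tree → List Tree → Tree

concl : Tree → Maybe Formula
concl emp       = nothing
concl (hyp A _) = just A
concl (nd A _ _) = just A

-- well-formedness: every discharge pointer targets an existing node below.
-- wf d t : t sits at depth d (number of nodes strictly below it).
mutual
  wf : ℕ → Tree → Set
  wf d emp              = ⊤
  wf d (hyp A nothing)  = ⊤
  wf d (hyp A (just k)) = suc k ≤ d
  wf d (nd A t ts)      = wf (suc d) t × wfs (suc d) ts

  wfs : ℕ → List Tree → Set
  wfs d []       = ⊤
  wfs d (t ∷ ts) = wf d t × wfs d ts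

WF : Tree → Set
WF T = wf 0 T

-- undischarged assumptions (the list of their labels; Γ is its set)
mutual
  assm : Tree → List Formula
  assm emp              = []
  assm (hyp A nothing)  = A ∷ []
  assm (hyp A (just _)) = []
  assm (nd A t ts)      = assm t ++ assms ts

  assms : List Tree → List Formula
  assms []       = []
  assms (t ∷ ts) = assm t ++ assms ts

Closed : Tree → Set
Closed T = assm T ≡ []

ClosedArgFor : Formula → Tree → Set
ClosedArgFor B D = WF D × Closed D × concl D ≡ just B

-- Restriction of f to a subtree: pointers leaving the subtree are dropped.
-- trim d t : t at depth d relative to the new root.
mutual
  trim : ℕ → Tree → Tree
  trim d emp              = emp
  trim d (hyp A nothing)  = hyp A nothing
  trim d (hyp A (just k)) = if suc k ≤ᵇ d then hyp A (just k) else hyp A nothing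
  trim d (nd A t ts)      = nd A (trim (suc d) t) (trims (suc d) ts)

  trims : ℕ → List Tree → List Tree
  trims d []       = []
  trims d (t ∷ ts) = trim d t ∷ trims d ts

-- immediate sub-structure rooted at a child t of the root
sub : Tree → Tree
sub t = trim 0 t

-- labels of the top-nodes discharged by the reference root (at depth 0)
mutual
  disch : ℕ → Tree → List Formula
  disch d emp              = []
  disch d (hyp A nothing)  = []
  disch d (hyp A (just k)) = if suc k ≡ᵇ d then A ∷ [] else []
  disch d (nd A t ts)      = disch (suc d) t ++ dischs (suc d) ts

  dischs : ℕ → List Tree → List Formula
  dischs d []       = []
  dischs d (t ∷ ts) = disch d t ++ dischs d ts

rootDisch : Tree → List Formula
rootDisch T = disch 0 T

mutual
  subst : (Formula → Tree) → Tree → Tree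
  subst σ emp              = emp
  subst σ (hyp A nothing)  = σ A
  subst σ (hyp A (just k)) = hyp A (just k)
  subst σ (nd A t ts)      = nd A (subst σ t) (substs σ ts)

  substs : (Formula → Tree) → List Tree → List Tree
  substs σ []       = []
  substs σ (t ∷ ts) = subst σ t ∷ substs σ ts

-- Atomic bases and their closed derivations.
-- A rule  ps ⇒ C  has premises  var p (p ∈ ps, so never ⊥)  and conclusion C.
-- A zero-premise rule is applied as  nd C emp [] .

mutual
  data CDer (R : List ℕ → Formula → Set) : Tree → Set where
    ax : ∀ {C} → R [] C → CDer R (nd C emp [])
    rl : ∀ {p ps C t ts} → R (p ∷ ps) C → CDers R (p ∷ ps) (t ∷ ts) →
         CDer R (nd C t ts)

  data CDers (R : List ℕ → Formula → Set) : List ℕ → List Tree → Set where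
    []  : CDers R [] []
    _∷_ : ∀ {p ps t ts} → CDer R t × concl t ≡ just (var p) →
          CDers R ps ts → CDers R (p ∷ ps) (t ∷ ts)

record Base : Set₁ where
  field
    rule       : List ℕ → Formula → Set
    rule-atom  : ∀ {ps C} → rule ps C → Atomic C
    consistent : ∀ T → CDer rule T → concl T ≡ just ⊥ᶠ → Empty

IsReduction : Tree → Tree → Set
IsReduction D₁ D₂ = WF D₁ × WF D₂ × concl D₂ ≡ concl D₁ × assm D₂ ⊆ assm D₁

record RSystem : Set₁ where
  field
    red   : Tree → Tree → Set
    isRed : ∀ {D₁ D₂} → red D₁ D₂ → IsReduction D₁ D₂
open RSystem public

_⊑_ : RSystem → RSystem → Set
S ⊑ S⁺ = ∀ {D₁ D₂} → red S D₁ D₂ → red S⁺ D₁ D₂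

-- D ≤^Σ D* : an r-sequence (of length ≥ 1) in Σ from D to D*
_≤[_]_ : Tree → RSystem → Tree → Set
D ≤[ S ] D* = TransClosure (red S) D D*

-- CV 𝔅 C D Σ : ⟨D,Σ⟩ (D closed with conclusion C) is SH-valid
-- on 𝔅; defined by recursion on C (clauses (i),(ii), with (iii) unfolded
-- for the open immediate sub-structure of an →-introduction, whose only
-- possible undischarged assumption is A).

CV : Base → Formula → Tree → RSystem → Set₁
CV 𝔅 (var n) D S = Lift (lsuc 0ℓ) (∃[ T ] (CDer (Base.rule 𝔅) T × D ≤[ S ] T))
CV 𝔅 ⊥ᶠ      D S = Lift (lsuc 0ℓ) (∃[ T ] (CDer (Base.rule 𝔅) T × D ≤[ S ] T))
CV 𝔅 (A ∧ᶠ B) D S = ∃[ t₁ ] ∃[ t₂ ]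
  ( D ≤[ S ] nd (A ∧ᶠ B) t₁ (t₂ ∷ [])
  × Closed (nd (A ∧ᶠ B) t₁ (t₂ ∷ []))
  × concl t₁ ≡ just A × concl t₂ ≡ just B
  × rootDisch (nd (A ∧ᶠ B) t₁ (t₂ ∷ [])) ≡ []
  × CV 𝔅 A (sub t₁) S × CV 𝔅 B (sub t₂) S )
CV 𝔅 (A ∨ᶠ B) D S = ∃[ t ]
  ( D ≤[ S ] nd (A ∨ᶠ B) t []
  × Closed (nd (A ∨ᶠ B) t [])
  × rootDisch (nd (A ∨ᶠ B) t []) ≡ []
  × ( (concl t ≡ just A × CV 𝔅 A (sub t) S)
    ⊎ (concl t ≡ just B × CV 𝔅 B (sub t) S) ) )
CV 𝔅 (A ⇒ B) D S = ∃[ t ]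
  ( D ≤[ S ] nd (A ⇒ B) t []
  × Closed (nd (A ⇒ B) t [])
  × concl t ≡ just B
  × All (_≡ A) (rootDisch (nd (A ⇒ B) t []))
  × (Closed (sub t) → CV 𝔅 B (sub t) S)
  × (¬ Closed (sub t) →
       ∀ (σ : Formula → Tree) (S⁺ : RSystem) → S ⊑ S⁺ →
       ClosedArgFor A (σ A) → CV 𝔅 A (σ A) S⁺ →
       CV 𝔅 B (subst σ (sub t)) S⁺) )

Valid : Base → Formula → Tree → RSystem → Set₁
Valid 𝔅 A D S =
    (Closed D → CV 𝔅 A D S)
  × (¬ Closed D →
       ∀ (σ : Formula → Tree) (S⁺ : RSystem) → S ⊑ S⁺ →
       (∀ B → B ∈ assm D → ClosedArgFor B (σ B) × CV 𝔅 B (σ B) S⁺) →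
       CV 𝔅 A (subst σ D) S⁺)

_⊨SH_ : List Formula → Formula → Set₁
Γ ⊨SH A = ∃[ D ] Σ RSystem λ S →
    WF D × assm D ⊆ Γ × Γ ⊆ assm D × concl D ≡ just A
  × (∀ (𝔅 : Base) → Valid 𝔅 A D S)

{-# OPTIONS --safe #-}
-- An r-system containing every reduction lets any argument reduce in one step
-- to any closed canonical argument with the same conclusion.  Under such an
-- r-system SH-validity on a base 𝔅 therefore collapses to a truth definition
-- in 𝔅 that reads ∨ and → classically (𝔅 ⊩ A); for the open premise of an
-- →-introduction it suffices to substitute the trivial closed argument for
-- the discharged assumption.  With excluded middle in the meta-language,
-- 𝔅 ⊩ A ∨ ¬A holds for every A.
module Submission where

open import Defs
open import Level using (0ℓ; Lift; lift) renaming (suc to lsuc)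
open import Axiom.ExcludedMiddle using (ExcludedMiddle)
open import Data.Nat using (ℕ; suc; s≤s; z≤n; _≤ᵇ_)
open import Data.Nat.Properties using (m≤n⇒m≤1+n)
open import Data.Bool using (true; false)
open import Data.Maybe using (just; nothing)
open import Data.List using (List; []; _∷_)
open import Data.List.Relation.Binary.Subset.Propositional using (_⊆_)
open import Data.List.Relation.Unary.All using ([]; _∷_)
open import Data.Product using (∃-syntax; _×_; _,_)
open import Data.Sum using (_⊎_; inj₁; inj₂)
open import Data.Unit using (tt)
open import Data.Empty using (⊥-elim)
open import Relation.Nullary using (Dec; yes; no)
open import Relation.Binary.PropositionalEquality using (_≡_; refl; sym; trans)
open import Relation.Binary.Construct.Closure.Transitive using ([_]; _∷_)

mutual
  wf-suc : ∀ d t → wf d t → wf (suc d) t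
  wf-suc d emp              _        = tt
  wf-suc d (hyp A nothing)  _        = tt
  wf-suc d (hyp A (just k)) k<d      = m≤n⇒m≤1+n k<d
  wf-suc d (nd A t ts)      (w , ws) = wf-suc (suc d) t w , wfs-suc (suc d) ts ws

  wfs-suc : ∀ d ts → wfs d ts → wfs (suc d) ts
  wfs-suc d []       _        = tt
  wfs-suc d (t ∷ ts) (w , ws) = wf-suc d t w , wfs-suc d ts ws

module _ {R : List ℕ → Formula → Set} where

  mutual
    CDer⇒wf : ∀ {t} → CDer R t → ∀ d → wf d t
    CDer⇒wf (ax _)    d = tt , tt
    CDer⇒wf (rl _ ds) d = CDers⇒wfs ds (suc d)

    CDers⇒wfs : ∀ {ps ts} → CDers R ps ts → ∀ d → wfs d ts
    CDers⇒wfs []             d = tt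
    CDers⇒wfs ((c , _) ∷ ds) d = CDer⇒wf c d , CDers⇒wfs ds d

  mutual
    CDer⇒Closed : ∀ {t} → CDer R t → Closed t
    CDer⇒Closed (ax _)    = refl
    CDer⇒Closed (rl _ ds) = CDers⇒closed ds

    CDers⇒closed : ∀ {ps ts} → CDers R ps ts → assms ts ≡ []
    CDers⇒closed [] = refl
    CDers⇒closed ((c , _) ∷ ds) rewrite CDer⇒Closed c | CDers⇒closed ds = refl

concl-trim : ∀ d t → concl (trim d t) ≡ concl t
concl-trim d emp              = refl
concl-trim d (hyp A nothing)  = refl
concl-trim d (hyp A (just k)) with suc k ≤ᵇ d
... | true  = refl
... | false = refl
concl-trim d (nd A t ts)      = refl

concl-subst : ∀ {σ} → (∀ B → concl (σ B) ≡ just B) → ∀ t → concl (subst σ t) ≡ concl t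
concl-subst σ-concl emp              = refl
concl-subst σ-concl (hyp A nothing)  = σ-concl A
concl-subst σ-concl (hyp A (just k)) = refl
concl-subst σ-concl (nd A t ts)      = refl

closed? : ∀ t → Dec (Closed t)
closed? t with assm t
... | []    = yes refl
... | _ ∷ _ = no λ ()

≡[]⇒⊆ : {xs ys : List Formula} → xs ≡ [] → xs ⊆ ys
≡[]⇒⊆ refl ()

≤-concl : ∀ {S D T} → D ≤[ S ] T → concl T ≡ concl D
≤-concl {S} [ r ]    = let (_ , _ , eq , _) = isRed S r in eq
≤-concl {S} (r ∷ rs) = let (_ , _ , eq , _) = isRed S r in trans (≤-concl {S} rs) eq

AllReductions : RSystem
AllReductions = record { red = IsReduction ; isRed = λ r → r }

≤-closed : ∀ S {D T} → AllReductions ⊑ S →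
           WF D → WF T → concl T ≡ concl D → Closed T → D ≤[ S ] T
≤-closed S full wD wT eq cl = [ full (wD , wT , eq , ≡[]⇒⊆ cl) ]

stub : Formula → Tree
stub A = nd A emp []

stub-closedArg : ∀ A → ClosedArgFor A (stub A)
stub-closedArg A = (tt , tt) , refl , refl

Derivable : Base → Formula → Set
Derivable 𝔅 C = ∃[ T ] (CDer (Base.rule 𝔅) T × concl T ≡ just C)

infix 3 _⊩_
_⊩_ : Base → Formula → Set₁
𝔅 ⊩ var n  = Lift (lsuc 0ℓ) (Derivable 𝔅 (var n))
𝔅 ⊩ ⊥ᶠ     = Lift (lsuc 0ℓ) (Derivable 𝔅 ⊥ᶠ)
𝔅 ⊩ A ∧ᶠ B = 𝔅 ⊩ A × 𝔅 ⊩ B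
𝔅 ⊩ A ∨ᶠ B = 𝔅 ⊩ A ⊎ 𝔅 ⊩ B
𝔅 ⊩ A ⇒ B  = 𝔅 ⊩ A → 𝔅 ⊩ B

concl-sub : ∀ {A} t → concl t ≡ just A → concl (sub t) ≡ just A
concl-sub t = trans (concl-trim 0 t)

module _ (𝔅 : Base) where

  Reduct⇒Derivable : ∀ S {D C} → ∃[ T ] (CDer (Base.rule 𝔅) T × D ≤[ S ] T) →
                     concl D ≡ just C → Derivable 𝔅 C
  Reduct⇒Derivable S (T , d , D≤T) e = T , d , trans (≤-concl {S} D≤T) e

  Derivable⇒Reduct : ∀ S {D C} → AllReductions ⊑ S → WF D → concl D ≡ just C →
                     Derivable 𝔅 C → ∃[ T ] (CDer (Base.rule 𝔅) T × D ≤[ S ] T)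
  Derivable⇒Reduct S full wD e (T , d , eT) =
    T , d , ≤-closed S full wD (CDer⇒wf d 0) (trans eT (sym e)) (CDer⇒Closed d)

  mutual
    CV⇒⊩ : ∀ {S} C {D} → AllReductions ⊑ S → CV 𝔅 C D S → concl D ≡ just C → 𝔅 ⊩ C
    CV⇒⊩ {S} (var n)  full (lift v) e = lift (Reduct⇒Derivable S v e)
    CV⇒⊩ {S} ⊥ᶠ       full (lift v) e = lift (Reduct⇒Derivable S v e)
    CV⇒⊩ (A ∧ᶠ B) full (t₁ , t₂ , _ , _ , e₁ , e₂ , _ , v₁ , v₂) _ =
      CV⇒⊩ A full v₁ (concl-sub t₁ e₁) , CV⇒⊩ B full v₂ (concl-sub t₂ e₂)
    CV⇒⊩ (A ∨ᶠ B) full (t , _ , _ , _ , inj₁ (e₁ , v)) _ = inj₁ (CV⇒⊩ A full v (concl-sub t e₁))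
    CV⇒⊩ (A ∨ᶠ B) full (t , _ , _ , _ , inj₂ (e₂ , v)) _ = inj₂ (CV⇒⊩ B full v (concl-sub t e₂))
    CV⇒⊩ {S} (A ⇒ B) full (t , _ , _ , eB , _ , closedCase , openCase) _ a with closed? (sub t)
    ... | yes cl = CV⇒⊩ B full (closedCase cl) (concl-sub t eB)
    ... | no op  = CV⇒⊩ B full
      (openCase op stub S (λ r → r) (stub-closedArg A) (⊩⇒CV A full a (tt , tt) refl))
      (trans (concl-subst (λ _ → refl) (sub t)) (concl-sub t eB))

    ⊩⇒CV : ∀ {S} C {D} → AllReductions ⊑ S → 𝔅 ⊩ C → WF D → concl D ≡ just C → CV 𝔅 C D S
    ⊩⇒CV {S} (var n)  full (lift v) wD e = lift (Derivable⇒Reduct S full wD e v)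
    ⊩⇒CV {S} ⊥ᶠ       full (lift v) wD e = lift (Derivable⇒Reduct S full wD e v)
    ⊩⇒CV {S} (A ∧ᶠ B) full (a , b) wD e =
      stub A , stub B , ≤-closed S full wD ((tt , tt) , (tt , tt) , tt) (sym e) refl ,
      refl , refl , refl , refl , ⊩⇒CV A full a (tt , tt) refl , ⊩⇒CV B full b (tt , tt) refl
    ⊩⇒CV {S} (A ∨ᶠ B) full (inj₁ a) wD e =
      stub A , ≤-closed S full wD ((tt , tt) , tt) (sym e) refl , refl , refl ,
      inj₁ (refl , ⊩⇒CV A full a (tt , tt) refl)
    ⊩⇒CV {S} (A ∨ᶠ B) full (inj₂ b) wD e =
      stub B , ≤-closed S full wD ((tt , tt) , tt) (sym e) refl , refl , refl ,
      inj₂ (refl , ⊩⇒CV B full b (tt , tt) refl)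
    -- The pointer just 1 discharges A at the root A ⇒ B, so the sub-structure
    -- above the root is the open one-step inference of B from A.
    ⊩⇒CV {S} (A ⇒ B)  full f wD e =
      nd B (hyp A (just 1)) [] , ≤-closed S full wD ((s≤s (s≤s z≤n) , tt) , tt) (sym e) refl ,
      refl , refl , refl ∷ [] , (λ ()) ,
      λ _ σ S⁺ S⊑S⁺ (wσA , _ , eσA) vσA →
        let full⁺ : AllReductions ⊑ S⁺
            full⁺ r = S⊑S⁺ (full r)
        in ⊩⇒CV B full⁺ (f (CV⇒⊩ A full⁺ vσA eσA)) (wf-suc 0 (σ A) wσA , tt) refl

closed⇒Valid : ∀ {𝔅} A {D S} → Closed D → CV 𝔅 A D S → Valid 𝔅 A D S
closed⇒Valid A cl v = (λ _ → v) , (λ ¬cl → ⊥-elim (¬cl cl))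

⊩-excludedMiddle : ExcludedMiddle (lsuc 0ℓ) → ∀ 𝔅 A → 𝔅 ⊩ A ∨ᶠ ¬ᶠ A
⊩-excludedMiddle em 𝔅 A with em {𝔅 ⊩ A}
... | yes a = inj₁ a
... | no ¬a = inj₂ (λ a → ⊥-elim (¬a a))

proposition6 : ExcludedMiddle (lsuc 0ℓ) → ∀ (A : Formula) → [] ⊨SH (A ∨ᶠ ¬ᶠ A)
proposition6 em A =
  stub (A ∨ᶠ ¬ᶠ A) , AllReductions , (tt , tt) , (λ ()) , (λ ()) , refl ,
  λ 𝔅 → closed⇒Valid (A ∨ᶠ ¬ᶠ A) refl
          (⊩⇒CV 𝔅 (A ∨ᶠ ¬ᶠ A) (λ r → r) (⊩-excludedMiddle em 𝔅 A) (tt , tt) refl)
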